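{- Let $n = 2^k p$, where $p$ is an odd prime and $k$ is a natural number, be a strongly $2$-near perfect number, and suppose $a$ is an integer with $0 \le a \le k$ such that $$p = \frac{2^{k+1} - 2^a - 1}{1 + 2^{k-a}}.$$ Then $k < 2a$.
   Context: $\sigma(n)$ denotes the sum of the positive divisors of $n$. A positive integer $n$ is called strongly $2$-near perfect if there is a positive divisor $d$ of $n$ with $d \ne n/d$ such that $\sigma(n) = 2n + d + \frac{n}{d}$. -}

module Defs where

open import Data.Nat using (ℕ; _+_; _*_)
open import Data.Nat.Divisibility using (_∣_; _∣?_)
open import Data.List using (List; filter; upTo; map)
open import Data.Nat.ListAction using (sum)
open import Data.Product using (∃; _×_)
open import Relation.Binary.PropositionalEquality using (_≡_; _≢_)

σ : ℕ → ℕ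
σ n = sum (filter (_∣? n) (map Data.Nat.suc (upTo n)))

-- n is strongly 2-near perfect: there is a positive divisor d of n with
-- d ≠ n/d and σ(n) = 2n + d + n/d.  Here e plays the role of n/d (d * e = n).
Strongly2NearPerfect : ℕ → Set
Strongly2NearPerfect n =
  ∃ λ d → ∃ λ e → d * e ≡ n × d ≢ e × σ n ≡ 2 * n + d + e

{-# OPTIONS --safe #-}
module Submission where

-- Put A = 2^a and B = 2^(k-a), so the hypothesis reads p(1 + B) + A + 1 = 2AB.
-- This forces p < 2A, and with q = 2A - p it becomes q(B + 1) = 3A + 1.
-- If 2a ≤ k then A divides B, so B ≥ A and q < 3; for powers of two the only
-- solution is q = 2, A = B = 1, which gives p = 0.

open import Defs
open import Data.Nat using (ℕ; zero; suc; _+_; _*_; _∸_; _^_; _≤_; _<_; _<?_; z≤n; s≤s)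
open import Data.Nat.Primality using (Prime)
open import Data.Nat.Divisibility using (_∣_; _∣0)
open import Data.Nat.Properties
open import Data.Nat.Tactic.RingSolver using (solve-∀)
open import Data.Product using (_×_; _,_)
open import Relation.Nullary using (¬_; yes; no; contradiction)
open import Relation.Binary.PropositionalEquality using (_≡_; _≢_; refl; sym; trans; cong; cong₂; module ≡-Reasoning)

2^n≢3 : ∀ n → 2 ^ n ≢ 3
2^n≢3 zero    ()
2^n≢3 (suc n) eq = even≢odd (2 ^ n) 1 eq

q*[A*C+1]≡3*A+1⇒q≡2∧a≡0 : ∀ q a c → let A = 2 ^ a; C = 2 ^ c in
                          q * (A * C + 1) ≡ 3 * A + 1 → q ≡ 2 × a ≡ 0
q*[A*C+1]≡3*A+1⇒q≡2∧a≡0 zero a c eq = contradiction (sym eq) (m+1+n≢0 (3 * 2 ^ a))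
q*[A*C+1]≡3*A+1⇒q≡2∧a≡0 1 a c eq = contradiction C≡3 (2^n≢3 c)
  where
    instance _ = m^n≢0 2 a
    A*C≡A*3 : 2 ^ a * 2 ^ c ≡ 2 ^ a * 3
    A*C≡A*3 = +-cancelʳ-≡ 1 _ _ (trans (sym (+-identityʳ _)) (trans eq (cong (_+ 1) (*-comm 3 (2 ^ a)))))
    C≡3 : 2 ^ c ≡ 3
    C≡3 = *-cancelˡ-≡ (2 ^ c) 3 (2 ^ a) A*C≡A*3
q*[A*C+1]≡3*A+1⇒q≡2∧a≡0 2 zero c eq = refl , refl
q*[A*C+1]≡3*A+1⇒q≡2∧a≡0 2 (suc a) c eq =
  contradiction (trans eq (reassociate (2 ^ a))) (even≢odd (2 ^ suc a * 2 ^ c + 1) (3 * 2 ^ a))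
  where
    reassociate : ∀ x → 3 * (2 * x) + 1 ≡ suc (2 * (3 * x))
    reassociate = solve-∀
q*[A*C+1]≡3*A+1⇒q≡2∧a≡0 (suc (suc (suc r))) a c eq = contradiction (sym eq) (<⇒≢ 3A+1<q[AC+1])
  where
    instance _ = m^n≢0 2 c
    A = 2 ^ a
    C = 2 ^ c
    3A+1<q[AC+1] : 3 * A + 1 < (3 + r) * (A * C + 1)
    3A+1<q[AC+1] = begin-strict
      3 * A + 1        <⟨ +-monoʳ-< (3 * A) (s≤s (s≤s z≤n)) ⟩
      3 * A + 3        ≡⟨ sym (*-distribˡ-+ 3 A 1) ⟩
      3 * (A + 1)      ≤⟨ *-monoʳ-≤ 3 (+-monoˡ-≤ 1 (m≤m*n A C)) ⟩
      3 * (A * C + 1)  ≤⟨ *-monoˡ-≤ (A * C + 1) (m≤m+n 3 r) ⟩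
      (3 + r) * (A * C + 1) ∎
      where open ≤-Reasoning

p*[1+B]+A+1≡2*A*B⇒p<2*A : ∀ p A B → p * (1 + B) + A + 1 ≡ 2 * (A * B) → p < 2 * A
p*[1+B]+A+1≡2*A*B⇒p<2*A p A B eq = ≰⇒> 2A≰p
  where
    2A≰p : ¬ (2 * A ≤ p)
    2A≰p 2A≤p = <-irrefl refl (begin-strict
      2 * (A * B)                    ≡⟨ sym (*-assoc 2 A B) ⟩
      2 * A * B                      ≤⟨ *-monoʳ-≤ (2 * A) (m≤n+m B 1) ⟩
      2 * A * (1 + B)                ≤⟨ m≤m+n (2 * A * (1 + B)) A ⟩
      2 * A * (1 + B) + A            <⟨ m<m+n (2 * A * (1 + B) + A) (s≤s z≤n) ⟩
      2 * A * (1 + B) + A + 1        ≤⟨ +-monoˡ-≤ 1 (+-monoˡ-≤ A (*-monoˡ-≤ (1 + B) 2A≤p)) ⟩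
      p * (1 + B) + A + 1            ≡⟨ eq ⟩
      2 * (A * B)                    ∎)
      where open ≤-Reasoning

p+q≡2*A⇒q*[B+1]≡3*A+1 : ∀ p q A B → p + q ≡ 2 * A → p * (1 + B) + A + 1 ≡ 2 * (A * B) →
                         q * (B + 1) ≡ 3 * A + 1
p+q≡2*A⇒q*[B+1]≡3*A+1 p q A B p+q≡2A eq = begin
  q * (B + 1)      ≡⟨ *-distribˡ-+ q B 1 ⟩
  q * B + q * 1    ≡⟨ cong₂ _+_ (sym p+A+1≡q*B) (*-identityʳ q) ⟩
  p + A + 1 + q    ≡⟨ shuffle p A q ⟩
  (p + q) + A + 1  ≡⟨ cong (λ x → x + A + 1) p+q≡2A ⟩
  2 * A + A + 1    ≡⟨ collect A ⟩
  3 * A + 1        ∎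
  where
    open ≡-Reasoning
    shuffle : ∀ p A q → p + A + 1 + q ≡ (p + q) + A + 1
    shuffle = solve-∀
    collect : ∀ A → 2 * A + A + 1 ≡ 3 * A + 1
    collect = solve-∀
    expand : ∀ p A B → p * (1 + B) + A + 1 ≡ p * B + (p + A + 1)
    expand = solve-∀
    p+A+1≡q*B : p + A + 1 ≡ q * B
    p+A+1≡q*B = +-cancelˡ-≡ (p * B) _ _ (begin
      p * B + (p + A + 1)  ≡⟨ expand p A B ⟨
      p * (1 + B) + A + 1  ≡⟨ eq ⟩
      2 * (A * B)          ≡⟨ *-assoc 2 A B ⟨
      2 * A * B            ≡⟨ cong (_* B) p+q≡2A ⟨
      (p + q) * B          ≡⟨ *-distribʳ-+ B p q ⟩
      p * B + q * B        ∎)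

p*[1+B]+A+1≢2*A*B : ∀ p a c → p ≢ 0 → let A = 2 ^ a; B = A * 2 ^ c in
                    p * (1 + B) + A + 1 ≢ 2 * (A * B)
p*[1+B]+A+1≢2*A*B p a c p≢0 eq = p≢0 p≡0
  where
    A = 2 ^ a
    B = A * 2 ^ c
    q = 2 * A ∸ p
    p+q≡2A : p + q ≡ 2 * A
    p+q≡2A = m+[n∸m]≡n (<⇒≤ (p*[1+B]+A+1≡2*A*B⇒p<2*A p A B eq))
    p≡0 : p ≡ 0
    p≡0 with q*[A*C+1]≡3*A+1⇒q≡2∧a≡0 q a c (p+q≡2*A⇒q*[B+1]≡3*A+1 p q A B p+q≡2A eq)
    ... | q≡2 , a≡0 = +-cancelʳ-≡ 2 p 0 (begin
      p + 2          ≡⟨ cong (p +_) q≡2 ⟨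
      p + q          ≡⟨ p+q≡2A ⟩
      2 * 2 ^ a      ≡⟨ cong (λ a → 2 * 2 ^ a) a≡0 ⟩
      2              ∎)
      where open ≡-Reasoning

2*a+c≡a+[a+c] : ∀ a c → 2 * a + c ≡ a + (a + c)
2*a+c≡a+[a+c] = solve-∀

2^[2*a+c∸a]≡2^a*2^c : ∀ a c → 2 ^ (2 * a + c ∸ a) ≡ 2 ^ a * 2 ^ c
2^[2*a+c∸a]≡2^a*2^c a c = begin
  2 ^ (2 * a + c ∸ a)      ≡⟨ cong (λ x → 2 ^ (x ∸ a)) (2*a+c≡a+[a+c] a c) ⟩
  2 ^ (a + (a + c) ∸ a)    ≡⟨ cong (2 ^_) (m+n∸m≡n a (a + c)) ⟩
  2 ^ (a + c)              ≡⟨ ^-distribˡ-+-* 2 a c ⟩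
  2 ^ a * 2 ^ c            ∎
  where open ≡-Reasoning

2^[2*a+c+1]≡2*2^a*[2^a*2^c] : ∀ a c → 2 ^ (2 * a + c + 1) ≡ 2 * (2 ^ a * (2 ^ a * 2 ^ c))
2^[2*a+c+1]≡2*2^a*[2^a*2^c] a c = begin
  2 ^ (2 * a + c + 1)            ≡⟨ cong (2 ^_) (+-comm (2 * a + c) 1) ⟩
  2 * 2 ^ (2 * a + c)            ≡⟨ cong (λ x → 2 * 2 ^ x) (2*a+c≡a+[a+c] a c) ⟩
  2 * 2 ^ (a + (a + c))          ≡⟨ cong (2 *_) (^-distribˡ-+-* 2 a (a + c)) ⟩
  2 * (2 ^ a * 2 ^ (a + c))      ≡⟨ cong (λ x → 2 * (2 ^ a * x)) (^-distribˡ-+-* 2 a c) ⟩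
  2 * (2 ^ a * (2 ^ a * 2 ^ c))  ∎
  where open ≡-Reasoning

lemma15 : (k p a : ℕ) → Prime p → ¬ (2 ∣ p) →
          Strongly2NearPerfect (2 ^ k * p) →
          a ≤ k →
          p * (1 + 2 ^ (k ∸ a)) + 2 ^ a + 1 ≡ 2 ^ (k + 1) →
          k < 2 * a
lemma15 k p a _ p-odd _ _ eq with k <? 2 * a
... | yes k<2a = k<2a
... | no k≮2a with m≤n⇒∃[o]m+o≡n (≮⇒≥ k≮2a)
... | c , refl = contradiction (begin
  p * (1 + 2 ^ a * 2 ^ c) + 2 ^ a + 1  ≡⟨ cong (λ B → p * (1 + B) + 2 ^ a + 1) (2^[2*a+c∸a]≡2^a*2^c a c) ⟨
  p * (1 + 2 ^ (k ∸ a)) + 2 ^ a + 1    ≡⟨ eq ⟩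
  2 ^ (k + 1)                          ≡⟨ 2^[2*a+c+1]≡2*2^a*[2^a*2^c] a c ⟩
  2 * (2 ^ a * (2 ^ a * 2 ^ c))        ∎) (p*[1+B]+A+1≢2*A*B p a c p≢0)
  where
    open ≡-Reasoning
    p≢0 : p ≢ 0
    p≢0 refl = p-odd (2 ∣0)
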